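{- For $n\ge 1$ let $G_n$ be the graph with vertex set $V=\{x\in\{ -1,1\}^{2n}:\sum_i x_i=0\}$, where $x\sim y$ iff $\mathrm{supp}(x-y)$ consists of two consecutive indices $\{i,i+1\}$ (equivalently, $y$ is obtained from $x$ by transposing adjacent unequal entries $x_i\ne x_{i+1}$). Then $\mathrm{Ric}(G_n)\ge -1$ for every $n$, and $\lim_{n\to\infty}\mathrm{Ric}(G_n)=-1$.
   Context: For a graph $G=(V,E)$ (undirected, simple, locally finite, no isolated vertices; $y\sim x$ means adjacency) and $f,g:V\to\mathbb R$ define $\Delta f(x)=\sum_{y\sim x}(f(y)-f(x))$, $\Gamma(f,g)(x)=\frac12\sum_{y\sim x}(f(x)-f(y))(g(x)-g(y))$, $\Gamma(f)=\Gamma(f,f)$, $\Gamma_2(f)=\frac12\Delta\Gamma(f)-\Gamma(f,\Delta f)$. The curvature $\mathrm{Ric}(G)$ is the largest $K\in\mathbb R$ such that $\Gamma_2(f)(x)\ge K\,\Gamma(f)(x)$ for all $f:V\to\mathbb R$ and all $x\in V$.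
   Formalization: The functions f take values in ℚ rather than ℝ, and the limit of the curvature is expressed through rational tolerances. -}

module Defs where

open import Data.Bool using (Bool; true; false; _xor_; if_then_else_)
open import Data.Nat using (ℕ; zero; suc) renaming (_+_ to _+ℕ_)
open import Data.List using (List; []; _∷_; _++_; map; foldr)
open import Data.Vec using (Vec; []; _∷_)
open import Data.Rational using (ℚ; 0ℚ; _+_; _*_; _-_; ½)
open import Relation.Binary.PropositionalEquality using (_≡_)

-- A point of {-1,1}^m is encoded as a Boolean vector: true ↦ +1, false ↦ -1.
Point : ℕ → Set
Point m = Vec Bool m

ones : ∀ {m} → Point m → ℕ
ones [] = 0
ones (true ∷ xs) = suc (ones xs)
ones (false ∷ xs) = ones xs

-- x ∈ V(G_n):  x ∈ {-1,1}^{2n} with Σ x_i = 0, i.e. exactly n entries are +1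
InV : (n : ℕ) → Point (n +ℕ n) → Set
InV n x = ones x ≡ n

-- Neighbours of x in G_n: all y obtained from x by transposing adjacent
-- unequal entries x_i ≠ x_{i+1} (one y per such i; distinct i give distinct y).
nbrs : ∀ {m} → Point m → List (Point m)
nbrs [] = []
nbrs (a ∷ []) = []
nbrs (a ∷ b ∷ xs) =
  (if a xor b then (b ∷ a ∷ xs) ∷ [] else [])
  ++ map (a ∷_) (nbrs (b ∷ xs))

sumℚ : List ℚ → ℚ
sumℚ = foldr _+_ 0ℚ

-- Functions V → ℚ (given on all of {-1,1}^m; only values on V are used,
-- since transpositions preserve V).
Fn : ℕ → Set
Fn m = Point m → ℚ

Δ : ∀ {m} → Fn m → Fn m
Δ f x = sumℚ (map (λ y → f y - f x) (nbrs x))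

Γ⟨_,_⟩ : ∀ {m} → Fn m → Fn m → Fn m
Γ⟨ f , g ⟩ x = ½ * sumℚ (map (λ y → (f x - f y) * (g x - g y)) (nbrs x))

Γ : ∀ {m} → Fn m → Fn m
Γ f = Γ⟨ f , f ⟩

Γ₂ : ∀ {m} → Fn m → Fn m
Γ₂ f x = ½ * Δ (Γ f) x - Γ⟨ f , Δ f ⟩ x

{-# OPTIONS --safe #-}
-- Write sᵢ for the transposition of positions i and i+1, and call i an edge at x when xᵢ ≠ xᵢ₊₁.
-- Expanding the definitions gives Γ₂ f x + Γ f x = Σᵢⱼ Wᵢⱼ + ½ Σᵢ qᵢ, where qᵢ = [i edge at x] (f x − f (sᵢ x))²
-- and Wᵢⱼ only involves f at x, sᵢ x, sⱼ x and sⱼ sᵢ x. Whether the positions i and j coincide, are adjacent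
-- or are apart (and then sᵢ and sⱼ commute), Wᵢⱼ + Wⱼᵢ exceeds πᵢⱼ qᵢ + πⱼᵢ qⱼ by a sum of squares, where π is 1
-- on the diagonal, −¾ next to it and 0 elsewhere. Every row of π sums to at least −½, so
-- Γ₂ f x + Γ f x ≥ Σᵢ (Σⱼ πᵢⱼ + ½) qᵢ ≥ 0.
-- For sharpness take x = (+,−,+,−,…) and the first moment f y = Σₖ k [yₖ = +1]: all K = 2n − 1 positions are
-- edges and Wᵢⱼ = πᵢⱼ, qᵢ = 1 exactly, so Γ₂ f x + Γ f x = Σᵢⱼ πᵢⱼ + K/2 = 3/2 while Γ f x = K/2,
-- i.e. Γ₂ f x = (−1 + 3/K) Γ f x.
module Submission where

open import Defs
open import Data.Nat using (ℕ) renaming (_+_ to _+ℕ_; _≤_ to _≤ℕ_)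
open import Data.Rational using (ℚ; _+_; _*_; -_; 1ℚ; 0ℚ; _≤_; _<_)
open import Data.Product using (Σ; _×_; ∃)

open import Algebra.Bundles using (CommutativeRing)
open import Data.Bool using (Bool; true; false; not; _xor_; if_then_else_)
open import Data.Bool.Properties using (xor-assoc; xor-comm; xor-same)
open import Data.Fin using (Fin; toℕ)
import Data.Fin as Fin
open import Data.Fin.Properties using (toℕ<n)
open import Data.Integer using (-[1+_])
import Data.Integer as ℤ
import Data.Integer.Properties as ℤₚ
open import Data.List using (List; []; _∷_; _++_; map)
open import Data.List.Properties using (map-++; map-∘)
import Data.Nat as ℕ
open import Data.Nat using (zero; suc; z≤n; s≤s)
import Data.Nat.Properties as ℕₚ
open import Data.Product using (_,_)
open import Data.Rational using (mkℚ; ½; _-_; _/_; 1/_; *≤*; *<*; nonNegative; nonPositive)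
open import Data.Rational.Literals using (fromℤ)
import Data.Rational.Properties as ℚ
open import Data.Sum using (inj₁; inj₂)
open import Data.Unit using (tt)
open import Data.Vec using ([]; _∷_)
open import Function using (_∘_)
open import Level using (0ℓ)
open import Relation.Binary.PropositionalEquality
open import Relation.Nullary.Decidable using (dec⇒maybe; toWitness)
open import Tactic.RingSolver using (solve-∀)
open import Tactic.RingSolver.Core.AlmostCommutativeRing using (AlmostCommutativeRing; fromCommutativeRing)
open import Algebra.Properties.Group ℚ.+-0-group using (⁻¹-involutive)
open import Algebra.Properties.CommutativeSemigroup (CommutativeRing.*-commutativeSemigroup ℚ.+-*-commutativeRing) using (x∙yz≈y∙xz)
open import Algebra.Properties.Semiring.Sum (CommutativeRing.semiring ℚ.+-*-commutativeRing) using (sum; ∑-distrib-+; ∑-comm; *-distribʳ-sum; sum-cong-≗; sum-replicate-zero)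

ℚ-ring : AlmostCommutativeRing 0ℓ 0ℓ
ℚ-ring = fromCommutativeRing ℚ.+-*-commutativeRing (λ p → dec⇒maybe (0ℚ ℚ.≟ p))

¼ : ℚ
¼ = ½ * ½

-¾ : ℚ
-¾ = - (½ + ¼)

χ : Bool → ℚ
χ true  = 1ℚ
χ false = 0ℚ

≤-by-slack : ∀ {p q} d → q ≡ p + d → 0ℚ ≤ d → p ≤ q
≤-by-slack {p} d refl 0≤d = subst (_≤ p + d) (ℚ.+-identityʳ p) (ℚ.+-monoʳ-≤ p 0≤d)

≤-swap-sums : ∀ {p q r s} → p + q ≤ r + s → q + p ≤ s + r
≤-swap-sums {p} {q} {r} {s} = subst₂ _≤_ (ℚ.+-comm p q) (ℚ.+-comm r s)

+-nonNeg : ∀ {p q} → 0ℚ ≤ p → 0ℚ ≤ q → 0ℚ ≤ p + q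
+-nonNeg = ℚ.+-mono-≤

*-nonNeg : ∀ {p q} → 0ℚ ≤ p → 0ℚ ≤ q → 0ℚ ≤ p * q
*-nonNeg {p} {q} 0≤p 0≤q =
  ℚ.nonNegative⁻¹ (p * q) {{ℚ.nonNeg*nonNeg⇒nonNeg p {{nonNegative 0≤p}} q {{nonNegative 0≤q}}}}

square-nonNeg : ∀ p → 0ℚ ≤ p * p
square-nonNeg p with ℚ.≤-total 0ℚ p
... | inj₁ 0≤p = *-nonNeg 0≤p 0≤p
... | inj₂ p≤0 = ℚ.nonNegative⁻¹ (p * p)
  {{ℚ.nonPos*nonPos⇒nonPos p {{nonPositive p≤0}} p {{nonPositive p≤0}}}}

scaled-square-nonNeg : ∀ {k} → 0ℚ ≤ k → ∀ p → 0ℚ ≤ k * (p * p)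
scaled-square-nonNeg 0≤k p = *-nonNeg 0≤k (square-nonNeg p)

½-nonNeg : 0ℚ ≤ ½
½-nonNeg = ℚ.≤ᵇ⇒≤ tt

¼-nonNeg : 0ℚ ≤ ¼
¼-nonNeg = ℚ.≤ᵇ⇒≤ tt

χ-nonNeg : ∀ b → 0ℚ ≤ χ b
χ-nonNeg true  = ℚ.≤ᵇ⇒≤ tt
χ-nonNeg false = ℚ.≤-refl

χ-idempotent : ∀ b → χ b * χ b ≡ χ b
χ-idempotent true  = refl
χ-idempotent false = refl

∑< : ℕ → (ℕ → ℚ) → ℚ
∑< n F = sum {n} (λ i → F (toℕ i))

syntax ∑< n (λ i → e) = ∑[ i < n ] e

∑-linear : (L : ℚ → ℚ → ℚ → ℚ → ℚ) →
  (∀ p q r s p′ q′ r′ s′ → L (p + p′) (q + q′) (r + r′) (s + s′) ≡ L p q r s + L p′ q′ r′ s′) →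
  L 0ℚ 0ℚ 0ℚ 0ℚ ≡ 0ℚ →
  ∀ n (P Q R S : ℕ → ℚ) → ∑[ j < n ] L (P j) (Q j) (R j) (S j) ≡ L (∑< n P) (∑< n Q) (∑< n R) (∑< n S)
∑-linear L L-+ L-0 zero    P Q R S = sym L-0
∑-linear L L-+ L-0 (suc n) P Q R S =
  trans (cong (L (P 0) (Q 0) (R 0) (S 0) +_) (∑-linear L L-+ L-0 n (P ∘ suc) (Q ∘ suc) (R ∘ suc) (S ∘ suc)))
        (sym (L-+ (P 0) (Q 0) (R 0) (S 0) _ _ _ _))

∑-mono-≤ : ∀ n {F G : ℕ → ℚ} → (∀ (i : Fin n) → F (toℕ i) ≤ G (toℕ i)) → ∑< n F ≤ ∑< n G
∑-mono-≤ zero    _   = ℚ.≤-refl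
∑-mono-≤ (suc n) {F} {G} F≤G = ℚ.+-mono-≤ (F≤G Fin.zero) (∑-mono-≤ n {F ∘ suc} {G ∘ suc} (F≤G ∘ Fin.suc))

∑-nonNeg : ∀ n {F : ℕ → ℚ} → (∀ (i : Fin n) → 0ℚ ≤ F (toℕ i)) → 0ℚ ≤ ∑< n F
∑-nonNeg n {F} 0≤F = subst (_≤ ∑< n F) (sum-replicate-zero n) (∑-mono-≤ n {λ _ → 0ℚ} {F} 0≤F)

∑∑-symmetrised : ∀ n (H : ℕ → ℕ → ℚ) →
  ∑[ i < n ] ∑[ j < n ] (H i j + H j i) ≡ ∑[ i < n ] ∑< n (H i) + ∑[ i < n ] ∑< n (H i)
∑∑-symmetrised n H = begin
    ∑[ i < n ] ∑[ j < n ] (H i j + H j i)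
  ≡⟨ sum-cong-≗ {n} (λ i → ∑-distrib-+ {n} (λ j → H (toℕ i) (toℕ j)) (λ j → H (toℕ j) (toℕ i))) ⟩
    ∑[ i < n ] (∑< n (H i) + ∑[ j < n ] H j i)
  ≡⟨ ∑-distrib-+ {n} (λ i → ∑< n (H (toℕ i))) (λ i → ∑[ j < n ] H j (toℕ i)) ⟩
    ∑[ i < n ] ∑< n (H i) + ∑[ i < n ] ∑[ j < n ] H j i
  ≡⟨ cong (∑[ i < n ] ∑< n (H i) +_) (∑-comm {n} {n} (λ i j → H (toℕ j) (toℕ i))) ⟩
    ∑[ i < n ] ∑< n (H i) + ∑[ i < n ] ∑< n (H i)
  ∎
  where open ≡-Reasoning

∑∑-mono-symmetric : ∀ n {F G : ℕ → ℕ → ℚ} →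
  (∀ (i j : Fin n) → G (toℕ i) (toℕ j) + G (toℕ j) (toℕ i) ≤ F (toℕ i) (toℕ j) + F (toℕ j) (toℕ i)) →
  ∑[ i < n ] ∑< n (G i) ≤ ∑[ i < n ] ∑< n (F i)
∑∑-mono-symmetric n {F} {G} G≤F =
  halve (subst₂ _≤_ (∑∑-symmetrised n G) (∑∑-symmetrised n F)
                    (∑-mono-≤ n {λ i → ∑[ j < n ] (G i j + G j i)} {λ i → ∑[ j < n ] (F i j + F j i)}
                       (λ i → ∑-mono-≤ n {λ j → G (toℕ i) j + G j (toℕ i)} {λ j → F (toℕ i) j + F j (toℕ i)} (G≤F i))))
  where
  half-double : ∀ p → ½ * (p + p) ≡ p
  half-double = solve-∀ ℚ-ring
  halve : ∀ {p q} → p + p ≤ q + q → p ≤ q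
  halve {p} {q} le = subst₂ _≤_ (half-double p) (half-double q) (ℚ.*-monoˡ-≤-nonNeg ½ le)

swap : ∀ {m} → ℕ → Point m → Point m
swap zero    (a ∷ b ∷ xs) = b ∷ a ∷ xs
swap (suc i) (a ∷ xs)     = a ∷ swap i xs
swap _       xs           = xs

canSwap : ∀ {m} → ℕ → Point m → Bool
canSwap zero    (a ∷ b ∷ _) = a xor b
canSwap (suc i) (_ ∷ xs)    = canSwap i xs
canSwap _       _           = false

sumℚ-++ : ∀ xs ys → sumℚ (xs ++ ys) ≡ sumℚ xs + sumℚ ys
sumℚ-++ []       ys = sym (ℚ.+-identityˡ _)
sumℚ-++ (x ∷ xs) ys = trans (cong (x +_) (sumℚ-++ xs ys)) (sym (ℚ.+-assoc x _ _))

∑-nbrs : ∀ {K} (x : Point (suc K)) (g : Point (suc K) → ℚ) →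
  sumℚ (map g (nbrs x)) ≡ ∑[ i < K ] (χ (canSwap i x) * g (swap i x))
∑-nbrs (a ∷ [])     g = refl
∑-nbrs (a ∷ b ∷ xs) g = begin
    sumℚ (map g (first ++ map (a ∷_) (nbrs (b ∷ xs))))
  ≡⟨ cong sumℚ (map-++ g first _) ⟩
    sumℚ (map g first ++ map g (map (a ∷_) (nbrs (b ∷ xs))))
  ≡⟨ sumℚ-++ (map g first) _ ⟩
    sumℚ (map g first) + sumℚ (map g (map (a ∷_) (nbrs (b ∷ xs))))
  ≡⟨ cong₂ _+_ (sum-first (a xor b))
               (trans (cong sumℚ (sym (map-∘ (nbrs (b ∷ xs))))) (∑-nbrs (b ∷ xs) (g ∘ (a ∷_)))) ⟩
    _
  ∎
  where
  open ≡-Reasoning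
  first : List (Point _)
  first = if a xor b then (b ∷ a ∷ xs) ∷ [] else []
  sum-first : ∀ t → sumℚ (map g (if t then (b ∷ a ∷ xs) ∷ [] else [])) ≡ χ t * g (b ∷ a ∷ xs)
  sum-first true  = trans (ℚ.+-identityʳ (g (b ∷ a ∷ xs))) (sym (ℚ.*-identityˡ (g (b ∷ a ∷ xs))))
  sum-first false = sym (ℚ.*-zeroˡ (g (b ∷ a ∷ xs)))

Γ-as-∑ : ∀ {K} (f g : Fn (suc K)) x →
  Γ⟨ f , g ⟩ x ≡ ½ * ∑[ i < K ] (χ (canSwap i x) * ((f x - f (swap i x)) * (g x - g (swap i x))))
Γ-as-∑ f g x = cong (½ *_) (∑-nbrs x (λ y → (f x - f y) * (g x - g y)))

Δ-as-∑ : ∀ {K} (f : Fn (suc K)) x → Δ f x ≡ ∑[ i < K ] (χ (canSwap i x) * (f (swap i x) - f x))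
Δ-as-∑ f x = ∑-nbrs x (λ y → f y - f x)

data Apart : ℕ → ℕ → Set where
  apartˡ    : ∀ {j} → Apart 0 (suc (suc j))
  apartʳ    : ∀ {i} → Apart (suc (suc i)) 0
  apart-suc : ∀ {i j} → Apart i j → Apart (suc i) (suc j)

apart-sym : ∀ {i j} → Apart i j → Apart j i
apart-sym apartˡ         = apartʳ
apart-sym apartʳ         = apartˡ
apart-sym (apart-suc d) = apart-suc (apart-sym d)

data Relative : ℕ → ℕ → Set where
  same  : ∀ {i} → Relative i i
  next  : ∀ {i} → Relative i (suc i)
  prev  : ∀ {i} → Relative (suc i) i
  apart : ∀ {i j} → Apart i j → Relative i j

relative : ∀ i j → Relative i j
relative zero          zero          = same
relative zero          (suc zero)    = next
relative zero          (suc (suc j)) = apart apartˡ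
relative (suc zero)    zero          = prev
relative (suc (suc i)) zero          = apart apartʳ
relative (suc i)       (suc j)       with relative i j
... | same    = same
... | next    = next
... | prev    = prev
... | apart d = apart (apart-suc d)

swap-involutive : ∀ {m} i (x : Point m) → swap i (swap i x) ≡ x
swap-involutive zero    []           = refl
swap-involutive zero    (a ∷ [])     = refl
swap-involutive zero    (a ∷ b ∷ xs) = refl
swap-involutive (suc i) []           = refl
swap-involutive (suc i) (a ∷ xs)     = cong (a ∷_) (swap-involutive i xs)

canSwap-swap-self : ∀ {m} i (x : Point m) → canSwap i (swap i x) ≡ canSwap i x
canSwap-swap-self zero    []           = refl
canSwap-swap-self zero    (a ∷ [])     = refl
canSwap-swap-self zero    (a ∷ b ∷ xs) = xor-comm b a
canSwap-swap-self (suc i) []           = refl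
canSwap-swap-self (suc i) (a ∷ xs)     = canSwap-swap-self i xs

swap-comm-apart : ∀ {m i j} → Apart i j → (x : Point m) → swap j (swap i x) ≡ swap i (swap j x)
swap-comm-apart apartˡ        []           = refl
swap-comm-apart apartˡ        (a ∷ [])     = refl
swap-comm-apart apartˡ        (a ∷ b ∷ xs) = refl
swap-comm-apart apartʳ        []           = refl
swap-comm-apart apartʳ        (a ∷ [])     = refl
swap-comm-apart apartʳ        (a ∷ b ∷ xs) = refl
swap-comm-apart (apart-suc d) []           = refl
swap-comm-apart (apart-suc d) (a ∷ xs)     = cong (a ∷_) (swap-comm-apart d xs)

canSwap-swap-apart : ∀ {m i j} → Apart i j → (x : Point m) → canSwap j (swap i x) ≡ canSwap j x
canSwap-swap-apart apartˡ        []           = refl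
canSwap-swap-apart apartˡ        (a ∷ [])     = refl
canSwap-swap-apart apartˡ        (a ∷ b ∷ xs) = refl
canSwap-swap-apart apartʳ        []           = refl
canSwap-swap-apart apartʳ        (a ∷ [])     = refl
canSwap-swap-apart apartʳ        (a ∷ b ∷ xs) = refl
canSwap-swap-apart (apart-suc d) []           = refl
canSwap-swap-apart (apart-suc d) (a ∷ xs)     = canSwap-swap-apart d xs

xor-cancel-middle : ∀ a b c → (a xor b) xor (b xor c) ≡ a xor c
xor-cancel-middle a b c = begin
  (a xor b) xor (b xor c) ≡⟨ xor-assoc a b (b xor c) ⟩
  a xor (b xor (b xor c)) ≡⟨ cong (a xor_) (xor-assoc b b c) ⟨
  a xor ((b xor b) xor c) ≡⟨ cong (λ t → a xor (t xor c)) (xor-same b) ⟩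
  a xor c                 ∎
  where open ≡-Reasoning

canSwap-next : ∀ {K} i (x : Point (suc K)) → suc i ℕ.< K →
  canSwap (suc i) (swap i x) ≡ canSwap i x xor canSwap (suc i) x
canSwap-next zero    (a ∷ b ∷ c ∷ _) _        = sym (xor-cancel-middle a b c)
canSwap-next zero    (a ∷ b ∷ [])    (s≤s ())
canSwap-next (suc i) (a ∷ xs)        (s≤s lt) = canSwap-next i xs lt

canSwap-prev : ∀ {K} i (x : Point (suc K)) → suc i ℕ.< K →
  canSwap i (swap (suc i) x) ≡ canSwap i x xor canSwap (suc i) x
canSwap-prev zero    (a ∷ b ∷ c ∷ _) _        = sym (xor-cancel-middle a b c)
canSwap-prev zero    (a ∷ b ∷ [])    (s≤s ())
canSwap-prev (suc i) (a ∷ xs)        (s≤s lt) = canSwap-prev i xs lt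

weight : ℕ → ℕ → ℚ
weight (suc i)    (suc j)    = weight i j
weight zero       zero       = 1ℚ
weight zero       (suc zero) = -¾
weight (suc zero) zero       = -¾
weight _          _          = 0ℚ

weight-same : ∀ i → weight i i ≡ 1ℚ
weight-same zero    = refl
weight-same (suc i) = weight-same i

weight-next : ∀ i → weight i (suc i) ≡ -¾
weight-next zero    = refl
weight-next (suc i) = weight-next i

weight-prev : ∀ i → weight (suc i) i ≡ -¾
weight-prev zero    = refl
weight-prev (suc i) = weight-prev i

weight-apart : ∀ {i j} → Apart i j → weight i j ≡ 0ℚ
weight-apart apartˡ         = refl
weight-apart apartʳ         = refl
weight-apart (apart-suc d) = weight-apart d

first-row : ∀ n → ∑< (suc (suc n)) (weight 0) ≡ ¼
first-row n = cong (λ t → 1ℚ + (-¾ + t)) (sum-replicate-zero n)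

first-column : ∀ n → ∑[ i < suc n ] weight (suc i) 0 ≡ -¾
first-column n = cong (-¾ +_) (sum-replicate-zero n)

first-row-bound : ∀ n → ¼ ≤ ∑< (suc n) (weight 0)
first-row-bound zero    = ℚ.≤ᵇ⇒≤ tt
first-row-bound (suc n) = ℚ.≤-reflexive (sym (first-row n))

row-bound : ∀ {n} i → i ℕ.< n → - ½ ≤ ∑< n (weight i)
row-bound {suc n}       zero          _        = ℚ.≤-trans (ℚ.≤ᵇ⇒≤ tt) (first-row-bound n)
row-bound {suc (suc n)} (suc zero)    _        = ℚ.≤-trans (ℚ.≤ᵇ⇒≤ tt) (ℚ.+-monoʳ-≤ -¾ (first-row-bound n))
row-bound {suc n}       (suc (suc i)) (s≤s lt) = subst (- ½ ≤_) (sym (ℚ.+-identityˡ _)) (row-bound (suc i) lt)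
row-bound {suc zero}    (suc zero)    (s≤s ())

total-weight : ∀ {K} → 1 ≤ℕ K → ∑[ i < K ] (∑< K (weight i) + ½) ≡ 1ℚ + ½
total-weight {suc zero}    _ = refl
total-weight {suc (suc k)} _ = begin
    (∑< (suc (suc k)) (weight 0) + ½) + ∑[ i < suc k ] ((weight (suc i) 0 + ∑< (suc k) (weight i)) + ½)
  ≡⟨ cong₂ (λ r s → (r + ½) + s) (first-row k)
           (trans (sum-cong-≗ {suc k} (λ i → ℚ.+-assoc (weight (suc (toℕ i)) 0) (∑< (suc k) (weight (toℕ i))) ½))
                  (∑-distrib-+ {suc k} (λ i → weight (suc (toℕ i)) 0) (λ i → ∑< (suc k) (weight (toℕ i)) + ½))) ⟩
    (¼ + ½) + (∑[ i < suc k ] weight (suc i) 0 + ∑[ i < suc k ] (∑< (suc k) (weight i) + ½))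
  ≡⟨ cong₂ (λ s t → (¼ + ½) + (s + t)) (first-column k) (total-weight {suc k} (s≤s z≤n)) ⟩
    (¼ + ½) + (-¾ + (1ℚ + ½))
  ≡⟨⟩
    1ℚ + ½
  ∎
  where open ≡-Reasoning

-- For y = sᵢ x and a = f x − f y, rowForm uᵢ a (2 Γ f y) (2 Γ f x) (Δ f x) (Δ f y) is the i-th term of Γ₂ f x.
-- Expanding its four arguments as sums over j, the j-th summand is pairTerm uᵢ uⱼ [j edge at y] (f x) (f y)
-- (f (sⱼ x)) (f (sⱼ y)). Both are INLINE so that the ring solver sees through them.
rowForm : (u a p q r s : ℚ) → ℚ
rowForm u a p q r s = ½ * (u * (½ * p - ½ * q)) - ½ * (u * (a * (r - s)))
{-# INLINE rowForm #-}

rowForm-additive : ∀ u a p q r s p′ q′ r′ s′ →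
  rowForm u a (p + p′) (q + q′) (r + r′) (s + s′) ≡ rowForm u a p q r s + rowForm u a p′ q′ r′ s′
rowForm-additive = solve-∀ ℚ-ring

rowForm-zero : ∀ u a → rowForm u a 0ℚ 0ℚ 0ℚ 0ℚ ≡ 0ℚ
rowForm-zero = solve-∀ ℚ-ring

pairTerm : (u v w c y y′ z : ℚ) → ℚ
pairTerm u v w c y y′ z =
  rowForm u (c - y) (w * ((y - z) * (y - z))) (v * ((c - y′) * (c - y′))) (v * (y′ - c)) (w * (z - y))
{-# INLINE pairTerm #-}

same-identity : ∀ u c y → pairTerm u u u c y y c ≡ u * u * ((c - y) * (c - y))
same-identity = solve-∀ ℚ-ring

same-pair : ∀ {w β z} α c y → w ≡ 1ℚ → β ≡ α → z ≡ c →
  w * (χ α * ((c - y) * (c - y))) + w * (χ α * ((c - y) * (c - y)))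
    ≤ pairTerm (χ α) (χ α) (χ β) c y y z + pairTerm (χ α) (χ α) (χ β) c y y z
same-pair α c y refl refl refl = ℚ.≤-reflexive (cong₂ _+_ diagonal diagonal)
  where
  diagonal : 1ℚ * (χ α * ((c - y) * (c - y))) ≡ pairTerm (χ α) (χ α) (χ α) c y y c
  diagonal = begin
    1ℚ * (χ α * ((c - y) * (c - y)))    ≡⟨ ℚ.*-identityˡ _ ⟩
    χ α * ((c - y) * (c - y))           ≡⟨ cong (_* ((c - y) * (c - y))) (χ-idempotent α) ⟨
    χ α * χ α * ((c - y) * (c - y))     ≡⟨ same-identity (χ α) c y ⟨
    pairTerm (χ α) (χ α) (χ α) c y y c  ∎
    where open ≡-Reasoning

apart-identity : ∀ u v c y y′ z →
  pairTerm u v v c y y′ z + pairTerm v u u c y′ y z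
    ≡ 0ℚ * (u * ((c - y) * (c - y))) + 0ℚ * (v * ((c - y′) * (c - y′)))
      + u * v * (½ * ((c - y - y′ + z) * (c - y - y′ + z)))
apart-identity = solve-∀ ℚ-ring

apart-pair : ∀ {wij wji βij βji zij zji} αi αj c yi yj →
  wij ≡ 0ℚ → wji ≡ 0ℚ → βij ≡ αj → βji ≡ αi → zij ≡ zji →
  wij * (χ αi * ((c - yi) * (c - yi))) + wji * (χ αj * ((c - yj) * (c - yj)))
    ≤ pairTerm (χ αi) (χ αj) (χ βij) c yi yj zij + pairTerm (χ αj) (χ αi) (χ βji) c yj yi zji
apart-pair {zij = z} αi αj c yi yj refl refl refl refl refl =
  ≤-by-slack _ (apart-identity (χ αi) (χ αj) c yi yj z)
    (*-nonNeg (*-nonNeg (χ-nonNeg αi) (χ-nonNeg αj)) (scaled-square-nonNeg ½-nonNeg (c - yi - yj + z)))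

adjacent-both-identity : ∀ c y y′ z z′ →
  pairTerm 1ℚ 1ℚ 0ℚ c y y′ z + pairTerm 1ℚ 1ℚ 0ℚ c y′ y z′
    ≡ -¾ * (1ℚ * ((c - y) * (c - y))) + -¾ * (1ℚ * ((c - y′) * (c - y′)))
      + ½ * ((c - y + (c - y′)) * (c - y + (c - y′)))
adjacent-both-identity = solve-∀ ℚ-ring

adjacent-one-identity : ∀ c y y′ z z′ →
  pairTerm 1ℚ 0ℚ 1ℚ c y y′ z + pairTerm 0ℚ 1ℚ 1ℚ c y′ y z′
    ≡ -¾ * (1ℚ * ((c - y) * (c - y))) + -¾ * (0ℚ * ((c - y′) * (c - y′)))
      + (¼ * ((y - z - (c - y)) * (y - z - (c - y))) + ½ * ((c - y) * (c - y)))
adjacent-one-identity = solve-∀ ℚ-ring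

adjacent-none-identity : ∀ c y y′ z z′ →
  -¾ * (0ℚ * ((c - y) * (c - y))) + -¾ * (0ℚ * ((c - y′) * (c - y′)))
    ≡ pairTerm 0ℚ 0ℚ 0ℚ c y y′ z + pairTerm 0ℚ 0ℚ 0ℚ c y′ y z′
adjacent-none-identity = solve-∀ ℚ-ring

adjacent-one-pair : ∀ c y y′ z z′ →
  -¾ * (1ℚ * ((c - y) * (c - y))) + -¾ * (0ℚ * ((c - y′) * (c - y′)))
    ≤ pairTerm 1ℚ 0ℚ 1ℚ c y y′ z + pairTerm 0ℚ 1ℚ 1ℚ c y′ y z′
adjacent-one-pair c y y′ z z′ =
  ≤-by-slack _ (adjacent-one-identity c y y′ z z′)
    (+-nonNeg (scaled-square-nonNeg ¼-nonNeg (y - z - (c - y))) (scaled-square-nonNeg ½-nonNeg (c - y)))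

adjacent-pair : ∀ {wij wji βij βji zij zji} αi αj c yi yj →
  wij ≡ -¾ → wji ≡ -¾ → βij ≡ αi xor αj → βji ≡ αi xor αj →
  wij * (χ αi * ((c - yi) * (c - yi))) + wji * (χ αj * ((c - yj) * (c - yj)))
    ≤ pairTerm (χ αi) (χ αj) (χ βij) c yi yj zij + pairTerm (χ αj) (χ αi) (χ βji) c yj yi zji
adjacent-pair {zij = z} {z′} true true c yi yj refl refl refl refl =
  ≤-by-slack _ (adjacent-both-identity c yi yj z z′) (scaled-square-nonNeg ½-nonNeg (c - yi + (c - yj)))
adjacent-pair {zij = z} {z′} true false c yi yj refl refl refl refl = adjacent-one-pair c yi yj z z′
adjacent-pair {zij = z} {z′} false true c yi yj refl refl refl refl =
  ≤-swap-sums { -¾ * (1ℚ * ((c - yj) * (c - yj)))} { -¾ * (0ℚ * ((c - yi) * (c - yi)))}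
              {pairTerm 1ℚ 0ℚ 1ℚ c yj yi z′} {pairTerm 0ℚ 1ℚ 1ℚ c yi yj z}
              (adjacent-one-pair c yj yi z′ z)
adjacent-pair {zij = z} {z′} false false c yi yj refl refl refl refl =
  ℚ.≤-reflexive (adjacent-none-identity c yi yj z z′)

module Local {K : ℕ} (f : Fn (suc K)) (x : Point (suc K)) where

  u : ℕ → ℚ
  u i = χ (canSwap i x)

  q : ℕ → ℚ
  q i = u i * ((f x - f (swap i x)) * (f x - f (swap i x)))

  W : ℕ → ℕ → ℚ
  W i j = pairTerm (u i) (u j) (χ (canSwap j (swap i x))) (f x) (f (swap i x)) (f (swap j x)) (f (swap j (swap i x)))

  decomposition : Γ₂ f x + Γ f x ≡ ∑[ i < K ] (∑< K (W i) + ½ * q i)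
  decomposition = begin
      ½ * Δ (Γ f) x - Γ⟨ f , Δ f ⟩ x + Γ f x
    ≡⟨ cong₂ (λ s t → ½ * s - t + Γ f x) (Δ-as-∑ (Γ f) x) (Γ-as-∑ f (Δ f) x) ⟩
      ½ * ∑< K A - ½ * ∑< K B + Γ f x
    ≡⟨ cong (½ * ∑< K A - ½ * ∑< K B +_) (Γ-as-∑ f f x) ⟩
      ½ * ∑< K A - ½ * ∑< K B + ½ * ∑< K q
    ≡⟨ ∑-linear (λ a b c _ → ½ * a - ½ * b + ½ * c) (solve-∀ ℚ-ring) refl K A B q (λ _ → 0ℚ) ⟨
      ∑[ i < K ] (½ * A i - ½ * B i + ½ * q i)
    ≡⟨ sum-cong-≗ {K} (λ i → cong (_+ ½ * q (toℕ i)) (row (toℕ i))) ⟩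
      ∑[ i < K ] (∑< K (W i) + ½ * q i)
    ∎
    where
    open ≡-Reasoning
    A B : ℕ → ℚ
    A i = u i * (Γ f (swap i x) - Γ f x)
    B i = u i * ((f x - f (swap i x)) * (Δ f x - Δ f (swap i x)))
    row : ∀ i → ½ * A i - ½ * B i ≡ ∑< K (W i)
    row i = begin
        ½ * (u i * (Γ f y - Γ f x)) - ½ * (u i * (a * (Δ f x - Δ f y)))
      ≡⟨ cong₂ (λ s t → ½ * (u i * (s - t)) - ½ * (u i * (a * (Δ f x - Δ f y)))) (Γ-as-∑ f f y) (Γ-as-∑ f f x) ⟩
        rowForm (u i) a (∑< K P) (∑< K Q) (Δ f x) (Δ f y)
      ≡⟨ cong₂ (rowForm (u i) a (∑< K P) (∑< K Q)) (Δ-as-∑ f x) (Δ-as-∑ f y) ⟩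
        rowForm (u i) a (∑< K P) (∑< K Q) (∑< K R) (∑< K S)
      ≡⟨ ∑-linear (rowForm (u i) a) (rowForm-additive (u i) a) (rowForm-zero (u i) a) K P Q R S ⟨
        ∑< K (W i)
      ∎
      where
      y : Point (suc K)
      y = swap i x
      a : ℚ
      a = f x - f y
      P Q R S : ℕ → ℚ
      P j = χ (canSwap j y) * ((f y - f (swap j y)) * (f y - f (swap j y)))
      Q j = χ (canSwap j x) * ((f x - f (swap j x)) * (f x - f (swap j x)))
      R j = χ (canSwap j x) * (f (swap j x) - f x)
      S j = χ (canSwap j y) * (f (swap j y) - f y)

  pair-bound : ∀ i j → i ℕ.< K → j ℕ.< K → weight i j * q i + weight j i * q j ≤ W i j + W j i
  pair-bound i j _ _ with relative i j
  pair-bound i .i _ _ | same =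
    same-pair (canSwap i x) (f x) (f (swap i x))
      (weight-same i) (canSwap-swap-self i x) (cong f (swap-involutive i x))
  pair-bound i .(suc i) _ i+1<K | next =
    adjacent-pair (canSwap i x) (canSwap (suc i) x) (f x) (f (swap i x)) (f (swap (suc i) x))
      (weight-next i) (weight-prev i) (canSwap-next i x i+1<K) (canSwap-prev i x i+1<K)
  pair-bound .(suc j) j j+1<K _ | prev =
    ≤-swap-sums {weight j (suc j) * q j} {weight (suc j) j * q (suc j)} {W j (suc j)} {W (suc j) j}
      (pair-bound j (suc j) (ℕₚ.<-trans (ℕₚ.n<1+n j) j+1<K) j+1<K)
  pair-bound i j _ _ | apart d =
    apart-pair (canSwap i x) (canSwap j x) (f x) (f (swap i x)) (f (swap j x))
      (weight-apart d) (weight-apart (apart-sym d))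
      (canSwap-swap-apart d x) (canSwap-swap-apart (apart-sym d) x) (cong f (swap-comm-apart d x))

  Γ₂+Γ-nonNeg : 0ℚ ≤ Γ₂ f x + Γ f x
  Γ₂+Γ-nonNeg = begin
      0ℚ
    ≤⟨ ∑-nonNeg K {λ i → (∑< K (weight i) + ½) * q i} (λ i → row-nonNeg (toℕ i) (toℕ<n i)) ⟩
      ∑[ i < K ] ((∑< K (weight i) + ½) * q i)
    ≡⟨ sum-cong-≗ {K} (λ i → split-row (toℕ i)) ⟩
      ∑[ i < K ] (∑[ j < K ] (weight i j * q i) + ½ * q i)
    ≡⟨ ∑-distrib-+ {K} (λ i → ∑[ j < K ] (weight (toℕ i) j * q (toℕ i))) (λ i → ½ * q (toℕ i)) ⟩
      ∑[ i < K ] ∑[ j < K ] (weight i j * q i) + ∑[ i < K ] (½ * q i)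
    ≤⟨ ℚ.+-monoˡ-≤ (∑[ i < K ] (½ * q i))
         (∑∑-mono-symmetric K {W} {λ i j → weight i j * q i}
           (λ i j → pair-bound (toℕ i) (toℕ j) (toℕ<n i) (toℕ<n j))) ⟩
      ∑[ i < K ] ∑< K (W i) + ∑[ i < K ] (½ * q i)
    ≡⟨ ∑-distrib-+ {K} (λ i → ∑< K (W (toℕ i))) (λ i → ½ * q (toℕ i)) ⟨
      ∑[ i < K ] (∑< K (W i) + ½ * q i)
    ≡⟨ decomposition ⟨
      Γ₂ f x + Γ f x
    ∎
    where
    open ℚ.≤-Reasoning
    row-nonNeg : ∀ i → i ℕ.< K → 0ℚ ≤ (∑< K (weight i) + ½) * q i
    row-nonNeg i i<K =
      *-nonNeg (subst (_≤ ∑< K (weight i) + ½) (ℚ.+-inverseˡ ½) (ℚ.+-monoˡ-≤ ½ (row-bound i i<K)))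
               (*-nonNeg (χ-nonNeg (canSwap i x)) (square-nonNeg (f x - f (swap i x))))
    split-row : ∀ i → (∑< K (weight i) + ½) * q i ≡ ∑[ j < K ] (weight i j * q i) + ½ * q i
    split-row i = trans (ℚ.*-distribʳ-+ (q i) (∑< K (weight i)) ½)
                        (cong (_+ ½ * q i) (*-distribʳ-sum {K} (q i) (λ j → weight i (toℕ j))))

Γ₂-lower-bound : ∀ {K} (f : Fn (suc K)) (x : Point (suc K)) → - Γ f x ≤ Γ₂ f x
Γ₂-lower-bound f x =
  subst₂ _≤_ (ℚ.+-identityˡ (- Γ f x)) (cancel (Γ₂ f x) (Γ f x)) (ℚ.+-monoˡ-≤ (- Γ f x) (Local.Γ₂+Γ-nonNeg f x))
  where
  cancel : ∀ p q → p + q + - q ≡ p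
  cancel = solve-∀ ℚ-ring

mass : ∀ {k} → Point k → ℚ
mass []       = 0ℚ
mass (b ∷ xs) = χ b + mass xs

-- moment y = Σₖ k [yₖ = +1]
moment : ∀ {k} → Point k → ℚ
moment []       = 0ℚ
moment (_ ∷ xs) = moment xs + mass xs

slope : ∀ {k} → ℕ → Point k → ℚ
slope zero    (a ∷ b ∷ _) = χ a - χ b
slope (suc i) (_ ∷ xs)    = slope i xs
slope _       _           = 0ℚ

mass-swap : ∀ {k} i (xs : Point k) → mass (swap i xs) ≡ mass xs
mass-swap zero    []           = refl
mass-swap zero    (a ∷ [])     = refl
mass-swap zero    (a ∷ b ∷ xs) = left-comm (χ b) (χ a) (mass xs)
  where left-comm : ∀ p q r → p + (q + r) ≡ q + (p + r)
        left-comm = solve-∀ ℚ-ring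
mass-swap (suc i) []           = refl
mass-swap (suc i) (a ∷ xs)     = cong (χ a +_) (mass-swap i xs)

moment-swap : ∀ {k} i (xs : Point k) → moment (swap i xs) ≡ moment xs + slope i xs
moment-swap zero    []           = sym (ℚ.+-identityʳ _)
moment-swap zero    (a ∷ [])     = sym (ℚ.+-identityʳ _)
moment-swap zero    (a ∷ b ∷ xs) = exchange (moment xs) (mass xs) (χ a) (χ b)
  where exchange : ∀ M m p q → M + m + (p + m) ≡ M + m + (q + m) + (p - q)
        exchange = solve-∀ ℚ-ring
moment-swap (suc i) []           = sym (ℚ.+-identityʳ _)
moment-swap (suc i) (a ∷ xs)     =
  trans (cong₂ _+_ (moment-swap i xs) (mass-swap i xs)) (shift (moment xs) (slope i xs) (mass xs))
  where shift : ∀ M s m → M + s + m ≡ M + m + s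
        shift = solve-∀ ℚ-ring

slope-square : ∀ {k} i (xs : Point k) → canSwap i xs ≡ true → slope i xs * slope i xs ≡ 1ℚ
slope-square zero    (true  ∷ false ∷ _) _ = refl
slope-square zero    (false ∷ true  ∷ _) _ = refl
slope-square zero    (true  ∷ true  ∷ _) ()
slope-square zero    (false ∷ false ∷ _) ()
slope-square zero    (_ ∷ [])            ()
slope-square zero    []                  ()
slope-square (suc i) []                  ()
slope-square (suc i) (_ ∷ xs)            h = slope-square i xs h

slope-next : ∀ {k} i (xs : Point k) → canSwap i xs ≡ true → canSwap (suc i) xs ≡ true →
  slope (suc i) xs ≡ - slope i xs
slope-next zero    (true  ∷ false ∷ true  ∷ _) _  _  = refl
slope-next zero    (false ∷ true  ∷ false ∷ _) _  _  = refl
slope-next zero    (true  ∷ true  ∷ _)         () _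
slope-next zero    (false ∷ false ∷ _)         () _
slope-next zero    (true  ∷ false ∷ false ∷ _) _  ()
slope-next zero    (false ∷ true  ∷ true  ∷ _) _  ()
slope-next zero    (_ ∷ _ ∷ [])                _  ()
slope-next zero    (_ ∷ [])                    () _
slope-next zero    []                          () _
slope-next (suc i) []                          () _
slope-next (suc i) (_ ∷ xs)                    h  h′ = slope-next i xs h h′

slope-swap-apart : ∀ {k i j} → Apart i j → (xs : Point k) → slope j (swap i xs) ≡ slope j xs
slope-swap-apart apartˡ        []           = refl
slope-swap-apart apartˡ        (a ∷ [])     = refl
slope-swap-apart apartˡ        (a ∷ b ∷ xs) = refl
slope-swap-apart apartʳ        []           = refl
slope-swap-apart apartʳ        (a ∷ [])     = refl
slope-swap-apart apartʳ        (a ∷ b ∷ xs) = refl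
slope-swap-apart (apart-suc d) []           = refl
slope-swap-apart (apart-suc d) (a ∷ xs)     = slope-swap-apart d xs

alternating : ∀ k → Bool → Point k
alternating zero    _ = []
alternating (suc k) b = b ∷ alternating k (not b)

ones-alternating : ∀ n → ones (alternating (n +ℕ n) true) ≡ n
ones-alternating zero    = refl
ones-alternating (suc n) rewrite ℕₚ.+-suc n n = cong suc (ones-alternating n)

canSwap-alternating : ∀ {K} i b → i ℕ.< K → canSwap i (alternating (suc K) b) ≡ true
canSwap-alternating {suc K} zero    true  _         = refl
canSwap-alternating {suc K} zero    false _         = refl
canSwap-alternating {suc K} (suc i) b     (s≤s i<K) = canSwap-alternating i (not b) i<K

gradient-unit : ∀ {α y} c s → α ≡ true → y ≡ c + s → s * s ≡ 1ℚ → χ α * ((c - y) * (c - y)) ≡ 1ℚ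
gradient-unit c s refl refl s²≡1 = trans (identity c s) s²≡1
  where identity : ∀ c s → 1ℚ * ((c - (c + s)) * (c - (c + s))) ≡ s * s
        identity = solve-∀ ℚ-ring

linear-same : ∀ {α β y z} c s → α ≡ true → β ≡ α → y ≡ c + s → z ≡ c → s * s ≡ 1ℚ →
  pairTerm (χ α) (χ α) (χ β) c y y z ≡ 1ℚ
linear-same c s refl refl refl refl s²≡1 = trans (identity c s) s²≡1
  where identity : ∀ c s → pairTerm 1ℚ 1ℚ 1ℚ c (c + s) (c + s) c ≡ s * s
        identity = solve-∀ ℚ-ring

linear-apart : ∀ {αi αj β yi yj z} c s t → αi ≡ true → αj ≡ true → β ≡ αj →
  yi ≡ c + s → yj ≡ c + t → z ≡ c + s + t → pairTerm (χ αi) (χ αj) (χ β) c yi yj z ≡ 0ℚ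
linear-apart c s t refl refl refl refl refl refl = identity c s t
  where identity : ∀ c s t → pairTerm 1ℚ 1ℚ 1ℚ c (c + s) (c + t) (c + s + t) ≡ 0ℚ
        identity = solve-∀ ℚ-ring

linear-adjacent : ∀ {αi αj β yi yj} c s z → αi ≡ true → αj ≡ true → β ≡ false →
  yi ≡ c + s → yj ≡ c + - s → s * s ≡ 1ℚ → pairTerm (χ αi) (χ αj) (χ β) c yi yj z ≡ -¾
linear-adjacent c s z refl refl refl refl refl s²≡1 =
  trans (identity c s z) (trans (cong (-¾ *_) s²≡1) (ℚ.*-identityʳ -¾))
  where identity : ∀ c s z → pairTerm 1ℚ 1ℚ 0ℚ c (c + s) (c + - s) z ≡ -¾ * (s * s)
        identity = solve-∀ ℚ-ring

ℕ→ℚ : ℕ → ℚ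
ℕ→ℚ n = fromℤ (ℤ.+ n)

ℕ→ℚ-+ : ∀ m n → ℕ→ℚ (m +ℕ n) ≡ ℕ→ℚ m + ℕ→ℚ n
ℕ→ℚ-+ m n = sym (trans (cong₂ (λ s t → (s ℤ.+ t) / 1) (ℤₚ.*-identityʳ (ℤ.+ m)) (ℤₚ.*-identityʳ (ℤ.+ n)))
                       (ℚ.normalize-coprime _))

ℕ→ℚ-* : ∀ m n → ℕ→ℚ (m ℕ.* n) ≡ ℕ→ℚ m * ℕ→ℚ n
ℕ→ℚ-* m n = sym (trans (cong (_/ 1) (sym (ℤₚ.pos-* m n))) (ℚ.normalize-coprime _))

ℕ→ℚ-mono : ∀ {m n} → m ≤ℕ n → ℕ→ℚ m ≤ ℕ→ℚ n
ℕ→ℚ-mono m≤n = *≤* (subst₂ ℤ._≤_ (sym (ℤₚ.*-identityʳ _)) (sym (ℤₚ.*-identityʳ _)) (ℤ.+≤+ m≤n))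

archimedean : ∀ ε → 0ℚ < ε → ∀ c → ∃ λ N → ∀ K → N ≤ℕ K → ℕ→ℚ c ≤ ε * ℕ→ℚ K
archimedean (mkℚ (ℤ.+ zero) _ _) (*<* (ℤ.+<+ ())) _
archimedean (mkℚ -[1+ _ ] _ _) (*<* ()) _
archimedean ε@(mkℚ (ℤ.+ suc p) d _) _ c = c ℕ.* suc d , bound
  where
  e : ℚ
  e = 1/ ℕ→ℚ (suc d)
  e≤ε : e ≤ ε
  e≤ε = *≤* (ℤ.+≤+ (ℕₚ.*-monoˡ-≤ (suc d) {1} {suc p} (s≤s z≤n)))
  bound : ∀ K → c ℕ.* suc d ≤ℕ K → ℕ→ℚ c ≤ ε * ℕ→ℚ K
  bound K N≤K = begin
    ℕ→ℚ c                       ≡⟨ ℚ.*-identityʳ _ ⟨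
    ℕ→ℚ c * 1ℚ                  ≡⟨ cong (ℕ→ℚ c *_) (ℚ.*-inverseˡ (ℕ→ℚ (suc d))) ⟨
    ℕ→ℚ c * (e * ℕ→ℚ (suc d))   ≡⟨ x∙yz≈y∙xz (ℕ→ℚ c) e (ℕ→ℚ (suc d)) ⟩
    e * (ℕ→ℚ c * ℕ→ℚ (suc d))   ≡⟨ cong (e *_) (ℕ→ℚ-* c (suc d)) ⟨
    e * ℕ→ℚ (c ℕ.* suc d)       ≤⟨ ℚ.*-monoˡ-≤-nonNeg e (ℕ→ℚ-mono N≤K) ⟩
    e * ℕ→ℚ K                   ≤⟨ ℚ.*-monoʳ-≤-nonNeg (ℕ→ℚ K) e≤ε ⟩
    ε * ℕ→ℚ K                   ∎
    where open ℚ.≤-Reasoning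

∑-ones : ∀ n → ∑[ i < n ] 1ℚ ≡ ℕ→ℚ n
∑-ones zero    = refl
∑-ones (suc n) = trans (cong (1ℚ +_) (∑-ones n)) (sym (ℕ→ℚ-+ 1 n))

module Alternating (K : ℕ) where

  x : Point (suc K)
  x = alternating (suc K) true

  open Local moment x

  valid : ∀ {i} → i ℕ.< K → canSwap i x ≡ true
  valid {i} = canSwap-alternating i true

  slope-unit : ∀ {i} → i ℕ.< K → slope i x * slope i x ≡ 1ℚ
  slope-unit {i} i<K = slope-square i x (valid i<K)

  q-value : ∀ {i} → i ℕ.< K → q i ≡ 1ℚ
  q-value {i} i<K = gradient-unit (moment x) (slope i x) (valid i<K) (moment-swap i x) (slope-unit i<K)

  adjacent-slopes : ∀ {i} → i ℕ.< K → suc i ℕ.< K → slope (suc i) x ≡ - slope i x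
  adjacent-slopes {i} i<K i+1<K = slope-next i x (valid i<K) (valid i+1<K)

  W-value : ∀ i j → i ℕ.< K → j ℕ.< K → W i j ≡ weight i j
  W-value i j _ _ with relative i j
  W-value i .i i<K _ | same =
    trans (linear-same (moment x) (slope i x) (valid i<K) (canSwap-swap-self i x) (moment-swap i x)
                       (cong moment (swap-involutive i x)) (slope-unit i<K))
          (sym (weight-same i))
  W-value i .(suc i) i<K i+1<K | next =
    trans (linear-adjacent (moment x) (slope i x) (moment (swap (suc i) (swap i x))) (valid i<K) (valid i+1<K)
                           (trans (canSwap-next i x i+1<K) (cong₂ _xor_ (valid i<K) (valid i+1<K)))
                           (moment-swap i x)
                           (trans (moment-swap (suc i) x) (cong (moment x +_) (adjacent-slopes i<K i+1<K)))
                           (slope-unit i<K))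
          (sym (weight-next i))
  W-value .(suc j) j j+1<K j<K | prev =
    trans (linear-adjacent (moment x) (slope (suc j) x) (moment (swap j (swap (suc j) x))) (valid j+1<K) (valid j<K)
                           (trans (canSwap-prev j x j+1<K) (cong₂ _xor_ (valid j<K) (valid j+1<K)))
                           (moment-swap (suc j) x)
                           (trans (moment-swap j x) (cong (moment x +_) opposite))
                           (slope-unit j+1<K))
          (sym (weight-prev j))
    where
    opposite : slope j x ≡ - slope (suc j) x
    opposite = trans (sym (⁻¹-involutive (slope j x))) (cong -_ (sym (adjacent-slopes j<K j+1<K)))
  W-value i j i<K j<K | apart d =
    trans (linear-apart (moment x) (slope i x) (slope j x) (valid i<K) (valid j<K) (canSwap-swap-apart d x)
                        (moment-swap i x) (moment-swap j x)
                        (trans (moment-swap j (swap i x)) (cong₂ _+_ (moment-swap i x) (slope-swap-apart d x))))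
          (sym (weight-apart d))

  Γ₂+Γ-value : 1 ≤ℕ K → Γ₂ moment x + Γ moment x ≡ 1ℚ + ½
  Γ₂+Γ-value 1≤K = begin
      Γ₂ moment x + Γ moment x
    ≡⟨ decomposition ⟩
      ∑[ i < K ] (∑< K (W i) + ½ * q i)
    ≡⟨ sum-cong-≗ {K} (λ i → cong₂ _+_ (sum-cong-≗ {K} (λ j → W-value (toℕ i) (toℕ j) (toℕ<n i) (toℕ<n j)))
                                        (trans (cong (½ *_) (q-value (toℕ<n i))) (ℚ.*-identityʳ ½))) ⟩
      ∑[ i < K ] (∑< K (weight i) + ½)
    ≡⟨ total-weight 1≤K ⟩
      1ℚ + ½
    ∎
    where open ≡-Reasoning

  Γ-value : Γ moment x ≡ ½ * ℕ→ℚ K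
  Γ-value = trans (Γ-as-∑ moment moment x)
                  (cong (½ *_) (trans (sum-cong-≗ {K} (λ i → q-value (toℕ<n i))) (∑-ones K)))

<-of-sum : ∀ {p q r e} → p + q ≡ r → r < e * q → p < (- 1ℚ + e) * q
<-of-sum {p} {q} {e = e} refl r<eq =
  subst₂ _<_ (cancel p q) (rearrange e q) (ℚ.+-monoˡ-< (- q) r<eq)
  where
  cancel : ∀ p q → p + q + - q ≡ p
  cancel = solve-∀ ℚ-ring
  rearrange : ∀ e q → e * q + - q ≡ (- 1ℚ + e) * q
  rearrange = solve-∀ ℚ-ring

Ric-tends-to-minus-one : (ε : ℚ) → 0ℚ < ε → Σ ℕ λ N → (n : ℕ) → 1 ≤ℕ n → N ≤ℕ n →
  Σ (Fn (n +ℕ n)) λ f → Σ (Point (n +ℕ n)) λ x → InV n x × (Γ₂ f x < (- 1ℚ + ε) * Γ f x)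
Ric-tends-to-minus-one ε 0<ε with archimedean ε 0<ε 4
... | N , large = N , witness
  where
  witness : (n : ℕ) → 1 ≤ℕ n → N ≤ℕ n →
    Σ (Fn (n +ℕ n)) λ f → Σ (Point (n +ℕ n)) λ x → InV n x × (Γ₂ f x < (- 1ℚ + ε) * Γ f x)
  witness (suc n) _ N≤n = moment , x , ones-alternating (suc n) , <-of-sum {e = ε} (Γ₂+Γ-value 1≤K) gap
    where
    K : ℕ
    K = n +ℕ suc n
    open Alternating K
    n≤K : suc n ≤ℕ K
    n≤K = ℕₚ.m≤n+m (suc n) n
    1≤K : 1 ≤ℕ K
    1≤K = ℕₚ.≤-trans (s≤s z≤n) n≤K
    gap : 1ℚ + ½ < ε * Γ moment x
    gap = begin-strict
      1ℚ + ½                <⟨ toWitness {a? = 1ℚ + ½ ℚ.<? ½ * ℕ→ℚ 4} tt ⟩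
      ½ * ℕ→ℚ 4             ≤⟨ ℚ.*-monoˡ-≤-nonNeg ½ (large K (ℕₚ.≤-trans N≤n n≤K)) ⟩
      ½ * (ε * ℕ→ℚ K)       ≡⟨ x∙yz≈y∙xz ½ ε (ℕ→ℚ K) ⟩
      ε * (½ * ℕ→ℚ K)       ≡⟨ cong (ε *_) Γ-value ⟨
      ε * Γ moment x        ∎
      where open ℚ.≤-Reasoning

theorem10 :
    ((n : ℕ) → 1 ≤ℕ n → (f : Fn (n +ℕ n)) → (x : Point (n +ℕ n)) → InV n x →
       - Γ f x ≤ Γ₂ f x)
    ×
    ((ε : ℚ) → 0ℚ < ε → Σ ℕ λ N → (n : ℕ) → 1 ≤ℕ n → N ≤ℕ n →
       Σ (Fn (n +ℕ n)) λ f → Σ (Point (n +ℕ n)) λ x → InV n x ×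
         (Γ₂ f x < (- 1ℚ + ε) * Γ f x))
theorem10 = Ric≥-1 , Ric-tends-to-minus-one
  where
  Ric≥-1 : (n : ℕ) → 1 ≤ℕ n → (f : Fn (n +ℕ n)) → (x : Point (n +ℕ n)) → InV n x → - Γ f x ≤ Γ₂ f x
  Ric≥-1 (suc n) _ f x _ = Γ₂-lower-bound f x
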